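{- \textsc{Greedy} cannot be better than a $(2/3)$-approximation on interval graphs, even when restricted to unit interval graphs of maximum degree $3$: for every $\varepsilon>0$ there exists a unit interval graph $G$ with maximum degree $3$ and an independent set $S$ that can be returned by \textsc{Greedy} on $G$ (for some tie-breaking) such that $|S| < (\frac{2}{3}+\varepsilon)\,\alpha(G)$, where $\alpha(G)$ is the size of a maximum independent set of $G$.
   Context: Graphs are finite, simple, undirected. A unit interval graph is a graph whose vertices can be represented by closed intervals of the real line, all of the same length, so that two vertices are adjacent iff their intervals intersect. \textsc{Greedy} is the minimum-degree greedy algorithm: start with $S=\emptyset$; while the current graph is nonempty, choose any vertex of minimum degree in the current graph (ties broken arbitrarily/adversarially), add it to $S$ and delete it together with all its neighbours. A solution "can be returned by \textsc{Greedy}" if it is the output for some sequence of tie-breaking choices.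
   Formalization: The parameter ε ranges over the positive rationals, and the unit intervals representing each graph are taken with rational endpoints rather than arbitrary real ones. -}

module Defs where

open import Data.Nat using (ℕ; suc)
open import Data.Bool using (Bool; true; false)
open import Data.Fin using (Fin)
open import Data.Fin.Subset using (Subset; ⊤; ⊥; ⁅_⁆; _∈_; _∩_; _∪_; _─_; ∣_∣; Empty)
open import Data.Vec using (tabulate)
open import Data.Product using (Σ; ∃; _×_; _,_)
open import Data.Integer using (+_)
open import Data.Rational using (ℚ; _-_; _≤_; _/_) renaming (∣_∣ to abs)
open import Relation.Binary.PropositionalEquality using (_≡_; _≢_)
open import Relation.Nullary using (¬_)
open import Function.Bundles using (_⇔_)

record Graph : Set where
  field
    n     : ℕ
    adj   : Fin n → Fin n → Bool
    sym   : ∀ u v → adj u v ≡ adj v u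
    irrefl : ∀ v → adj v v ≡ false
open Graph public

Adjacent : (G : Graph) → Fin (n G) → Fin (n G) → Set
Adjacent G u v = adj G u v ≡ true

N : (G : Graph) → Fin (n G) → Subset (n G)
N G v = tabulate (λ u → adj G v u)

N[_] : (G : Graph) → Fin (n G) → Subset (n G)
N[ G ] v = ⁅ v ⁆ ∪ N G v

degree : (G : Graph) → Fin (n G) → ℕ
degree G v = ∣ N G v ∣

degreeIn : (G : Graph) → Subset (n G) → Fin (n G) → ℕ
degreeIn G R v = ∣ R ∩ N G v ∣

MaxDegreeAtMost : Graph → ℕ → Set
MaxDegreeAtMost G d = ∀ v → degree G v Data.Nat.≤ d

-- Unit interval graph: vertex v is represented by the closed interval
-- [ l v , l v + 1 ]; two such intervals intersect iff |l u - l v| ≤ 1.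
-- (Endpoints are rational; every finite unit interval graph has such
--  a representation.)
IsUnitInterval : Graph → Set
IsUnitInterval G =
  Σ (Fin (n G) → ℚ) λ l →
    ∀ u v → u ≢ v → (Adjacent G u v ⇔ (abs (l u - l v) ≤ (+ 1 / 1)))

IsIndependent : (G : Graph) → Subset (n G) → Set
IsIndependent G T = ∀ u v → u ∈ T → v ∈ T → ¬ Adjacent G u v

IsIndependenceNumber : Graph → ℕ → Set
IsIndependenceNumber G a =
  (Σ (Subset (n G)) λ T → IsIndependent G T × ∣ T ∣ ≡ a) ×
  (∀ T → IsIndependent G T → ∣ T ∣ Data.Nat.≤ a)

-- GreedyRun G R S : running Greedy on the induced subgraph G[R]
-- can (for some tie-breaking) return the set S.
data GreedyRun (G : Graph) : Subset (n G) → Subset (n G) → Set where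
  done : ∀ {R} → Empty R → GreedyRun G R ⊥
  step : ∀ {R S} (v : Fin (n G)) →
         v ∈ R →
         (∀ u → u ∈ R → degreeIn G R v Data.Nat.≤ degreeIn G R u) →
         GreedyRun G (R ─ N[ G ] v) S →
         GreedyRun G R (⁅ v ⁆ ∪ S)

GreedyReturns : (G : Graph) → Subset (n G) → Set
GreedyReturns G S = GreedyRun G ⊤ S

{-# OPTIONS --safe #-}
module Submission where

-- chain k is a row of k + 1 triangles v₀v₁v₂, the vertex v₂ of each joined to the vertex v₀
-- of the next by a path v₂ v₃ v₄ v₅ v₀; it is a unit interval graph all of whose degrees
-- are 2 or 3. Greedy may first take v₄, deleting v₃ v₄ v₅, and then v₀, deleting the now
-- isolated first triangle; what is left is chain (k - 1), so Greedy can return 2k + 1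
-- vertices. On the other hand v₁, v₃, v₅ of every block together with v₁ of the last
-- triangle are independent, while the 3k + 1 cliques {v₀,v₁,v₂}, {v₃,v₄}, {v₅} of the
-- blocks and the last triangle cover all vertices, so α = 3k + 1; and (2k + 1) / (3k + 1)
-- tends to 2/3.

open import Defs
open import Data.Nat using (ℕ; zero; suc)
open import Data.Integer using (+_)
open import Data.Rational using (ℚ; _+_; _*_; _<_; _/_; 0ℚ)
open import Data.Fin.Subset using (Subset; ∣_∣)
open import Data.Product using (Σ; _×_)

open import Data.Bool using (false; not; _∧_)
open import Data.Bool.Properties using (T-≡)
open import Data.Empty using (⊥-elim)
open import Data.Fin using (Fin; zero; suc; toℕ)
open import Data.Fin.Properties using (_≟_; suc-injective; 0≢1+n)
open import Data.Fin.Subset using (⊤; ⊥; ⁅_⁆; _∈_; _∉_; _⊆_; _∩_; _∪_; _─_; Empty; inside; outside)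
open import Data.Fin.Subset.Properties
  using (∈⊤; ∉⊥; ∣⊤∣≡n; ∣⊥∣≡0; ∣p∣≤∣x∷p∣; ∣p∩q∣≤∣q∣; x∈p∪q⁻; q⊆p∪q; x∈⁅y⁆⇒x≡y; p─q⊆p; p─⊥≡p;
         x∈p∧x≢y⇒x∈p-y; x∈p⇒∣p-x∣<∣p∣; ∪-identityˡ)
open import Data.Integer as ℤ using (_⊖_; +[1+_]; -[1+_]; +<+)
import Data.Integer.Properties as ℤ
open import Data.Nat as ℕ using (z≤n; s≤s; _≤_; _≤ᵇ_; ∣_-_∣)
open import Data.Nat.Properties
  using (≤-reflexive; ≤-trans; ≤-<-trans; ≤-total; ≤ᵇ⇒≤; ≤⇒≤ᵇ; ∣-∣-comm; ∸-mono; m≤n⇒∣m-n∣≡n∸m;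
         m+n∸m≡n; +-monoʳ-≤; *-monoˡ-≤; *-cancelʳ-≤; m<m+n)
open import Data.Nat.Tactic.RingSolver using (solve-∀)
open import Data.Product using (_,_)
import Data.Rational as ℚ
open import Data.Rational using (mkℚ; toℚᵘ)
open import Data.Rational.Properties
  using (toℚᵘ-mono-≤; toℚᵘ-cancel-≤; toℚᵘ-cancel-<; toℚᵘ-fromℚᵘ; toℚᵘ-homo-+; toℚᵘ-homo‿-;
         toℚᵘ-homo-*; toℚᵘ-homo-∣-∣)
open import Data.Rational.Unnormalised as ℚᵘ using (mkℚᵘ; *≤*; *<*) renaming (_≃_ to _≃ᵘ_)
open import Data.Rational.Unnormalised.Properties
  using (≃-sym; ≃-trans; ≤-respˡ-≃; ∣-∣-cong; +-cong; *-cong; -‿cong)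
open import Data.Sum using (inj₁; inj₂)
open import Data.Unit using (tt)
open import Data.Vec using (_∷_; []; tabulate; allFin; here; there)
open import Data.Vec.Properties using (lookup∘tabulate; lookup⇒[]=; tabulate-allFin; map-const; tabulate-cong)
open import Function using (_∘_; case_of_)
open import Function.Bundles using (_⇔_; mk⇔; Equivalence)
open import Function.Properties.Equivalence using () renaming (trans to ⇔-trans; sym to ⇔-sym)
open import Relation.Binary.PropositionalEquality as ≡
  using (_≡_; _≢_; refl; cong; cong₂; subst; subst₂; trans)
open import Relation.Nullary using (¬_; yes; no; does)
open import Relation.Nullary.Decidable using (dec-true; dec-false; does-⇔)

x∈p─q⇒x∉q : ∀ {m} {x : Fin m} (p q : Subset m) → x ∈ p ─ q → x ∉ q
x∈p─q⇒x∉q (_ ∷ _) (inside ∷ _) () here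
x∈p─q⇒x∉q (_ ∷ p) (_ ∷ q) (there x∈p─q) (there x∈q) = x∈p─q⇒x∉q p q x∈p─q x∈q

outside∷p─b∷q : ∀ {m} b (p q : Subset m) → (outside ∷ p) ─ (b ∷ q) ≡ outside ∷ (p ─ q)
outside∷p─b∷q inside _ _ = refl
outside∷p─b∷q outside _ _ = refl

∣b∷p∣-outside : ∀ {m b} (p : Subset m) → b ≡ outside → ∣ b ∷ p ∣ ≡ ∣ p ∣
∣b∷p∣-outside _ refl = refl

tabulate-outside : ∀ m → tabulate {n = m} (λ _ → outside) ≡ ⊥
tabulate-outside m = trans (tabulate-allFin _) (map-const (allFin m) outside)

∣tabulate-outside∣ : ∀ m → ∣ tabulate {n = m} (λ _ → outside) ∣ ≡ 0
∣tabulate-outside∣ m = trans (cong ∣_∣ (tabulate-outside m)) (∣⊥∣≡0 m)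

⊤─tabulate-outside : ∀ m → ⊤ ─ (⊥ ∪ tabulate {n = m} (λ _ → outside)) ≡ ⊤
⊤─tabulate-outside m = trans (cong (⊤ ─_) (trans (∪-identityˡ _) (tabulate-outside m))) (p─⊥≡p ⊤)

∣p∣≤∣q∣-by-injection : ∀ {m m′} {p : Subset m} {q : Subset m′} (f : Fin m → Fin m′) →
                       (∀ {u} → u ∈ p → f u ∈ q) →
                       (∀ {u v} → u ∈ p → v ∈ p → f u ≡ f v → u ≡ v) →
                       ∣ p ∣ ≤ ∣ q ∣
∣p∣≤∣q∣-by-injection {p = []} _ _ _ = z≤n
∣p∣≤∣q∣-by-injection {p = outside ∷ p} f into injective =
  ∣p∣≤∣q∣-by-injection (f ∘ suc) (into ∘ there)
    (λ u∈p v∈p eq → suc-injective (injective (there u∈p) (there v∈p) eq))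
∣p∣≤∣q∣-by-injection {p = inside ∷ p} {q} f into injective =
  ≤-<-trans (∣p∣≤∣q∣-by-injection (f ∘ suc) into-q─f0
              (λ u∈p v∈p eq → suc-injective (injective (there u∈p) (there v∈p) eq)))
            (x∈p⇒∣p-x∣<∣p∣ (into here))
  where
  into-q─f0 : ∀ {u} → u ∈ p → f (suc u) ∈ q ─ ⁅ f zero ⁆
  into-q─f0 u∈p = x∈p∧x≢y⇒x∈p-y (into (there u∈p)) (λ eq → 0≢1+n (injective here (there u∈p) (≡.sym eq)))

∣a-b∣≤d-in-[s,s+d] : ∀ {s d a b} → s ≤ a → a ≤ s ℕ.+ d → s ≤ b → b ≤ s ℕ.+ d → ∣ a - b ∣ ≤ d
∣a-b∣≤d-in-[s,s+d] {s} {d} {a} {b} s≤a a≤s+d s≤b b≤s+d with ≤-total a b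
... | inj₁ a≤b = begin
  ∣ a - b ∣      ≡⟨ m≤n⇒∣m-n∣≡n∸m a≤b ⟩
  b ℕ.∸ a        ≤⟨ ∸-mono b≤s+d s≤a ⟩
  s ℕ.+ d ℕ.∸ s  ≡⟨ m+n∸m≡n s d ⟩
  d              ∎
  where open Data.Nat.Properties.≤-Reasoning
... | inj₂ b≤a = begin
  ∣ a - b ∣      ≡⟨ ∣-∣-comm a b ⟩
  ∣ b - a ∣      ≡⟨ m≤n⇒∣m-n∣≡n∸m b≤a ⟩
  a ℕ.∸ b        ≤⟨ ∸-mono a≤s+d s≤b ⟩
  s ℕ.+ d ℕ.∸ s  ≡⟨ m+n∸m≡n s d ⟩
  d              ∎
  where open Data.Nat.Properties.≤-Reasoning

module _ (G : Graph) where

  ¬adjacent-self : ∀ v → ¬ Adjacent G v v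
  ¬adjacent-self v a = case trans (≡.sym (irrefl G v)) a of λ ()

  adjacent⇒∈N[] : ∀ {v u} → Adjacent G v u → u ∈ N[ G ] v
  adjacent⇒∈N[] {v} {u} a =
    q⊆p∪q ⁅ v ⁆ (N G v) (lookup⇒[]= u (N G v) (trans (lookup∘tabulate (adj G v) u) a))

  greedyRun-⊆ : ∀ {R S} → GreedyRun G R S → S ⊆ R
  greedyRun-⊆ (done _) x∈⊥ = ⊥-elim (∉⊥ x∈⊥)
  greedyRun-⊆ (step {R} {S} v v∈R _ run) x∈ with x∈p∪q⁻ ⁅ v ⁆ S x∈
  ... | inj₁ x∈⁅v⁆ = subst (_∈ R) (≡.sym (x∈⁅y⁆⇒x≡y v x∈⁅v⁆)) v∈R
  ... | inj₂ x∈S = p─q⊆p R (N[ G ] v) (greedyRun-⊆ run x∈S)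

  ≁-later-choice : ∀ {R S v x} → GreedyRun G (R ─ N[ G ] v) S → x ∈ S → ¬ Adjacent G v x
  ≁-later-choice {R} {v = v} run x∈S a = x∈p─q⇒x∉q R (N[ G ] v) (greedyRun-⊆ run x∈S) (adjacent⇒∈N[] a)

  greedyRun-independent : ∀ {R S} → GreedyRun G R S → IsIndependent G S
  greedyRun-independent (done _) u _ u∈⊥ _ = ⊥-elim (∉⊥ u∈⊥)
  greedyRun-independent (step {R} {S} v _ _ run) u w u∈ w∈
    with x∈p∪q⁻ ⁅ v ⁆ S u∈ | x∈p∪q⁻ ⁅ v ⁆ S w∈
  ... | inj₁ u∈⁅v⁆ | inj₁ w∈⁅v⁆
    rewrite x∈⁅y⁆⇒x≡y v u∈⁅v⁆ | x∈⁅y⁆⇒x≡y v w∈⁅v⁆ = ¬adjacent-self v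
  ... | inj₁ u∈⁅v⁆ | inj₂ w∈S rewrite x∈⁅y⁆⇒x≡y v u∈⁅v⁆ = ≁-later-choice run w∈S
  ... | inj₂ u∈S | inj₁ w∈⁅v⁆ rewrite x∈⁅y⁆⇒x≡y v w∈⁅v⁆ =
    ≁-later-choice run u∈S ∘ trans (Graph.sym G v u)
  ... | inj₂ u∈S | inj₂ w∈S = greedyRun-independent run u w u∈S w∈S

  greedy-step : ∀ {R S} v → v ∈ R → (∀ u → u ∈ R → degree G v ≤ degreeIn G R u) →
                GreedyRun G (R ─ N[ G ] v) S → GreedyRun G R (⁅ v ⁆ ∪ S)
  greedy-step {R} v v∈R v-minimal =
    step v v∈R (λ u u∈R → ≤-trans (∣p∩q∣≤∣q∣ R (N G v)) (v-minimal u u∈R))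

∣m⊖n∣≡∣m-n∣ : ∀ m n → ℤ.∣ m ⊖ n ∣ ≡ ∣ m - n ∣
∣m⊖n∣≡∣m-n∣ zero zero = refl
∣m⊖n∣≡∣m-n∣ zero (suc n) = refl
∣m⊖n∣≡∣m-n∣ (suc m) zero = refl
∣m⊖n∣≡∣m-n∣ (suc m) (suc n) = trans (cong ℤ.∣_∣ (ℤ.[1+m]⊖[1+n]≡m⊖n m n)) (∣m⊖n∣≡∣m-n∣ m n)

∣a*2-b*2∣≡∣a-b∣*2 : ∀ a b → ℤ.∣ + a ℤ.* + 2 ℤ.+ ℤ.- (+ b) ℤ.* + 2 ∣ ≡ ∣ a - b ∣ ℕ.* 2
∣a*2-b*2∣≡∣a-b∣*2 a b = begin
  ℤ.∣ + a ℤ.* + 2 ℤ.+ ℤ.- (+ b) ℤ.* + 2 ∣  ≡⟨ cong ℤ.∣_∣ (≡.sym (ℤ.*-distribʳ-+ (+ 2) (+ a) (ℤ.- + b))) ⟩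
  ℤ.∣ (+ a ℤ.- + b) ℤ.* + 2 ∣              ≡⟨ ℤ.abs-* (+ a ℤ.- + b) (+ 2) ⟩
  ℤ.∣ + a ℤ.- + b ∣ ℕ.* 2                  ≡⟨ cong (λ z → ℤ.∣ z ∣ ℕ.* 2) (ℤ.m-n≡m⊖n a b) ⟩
  ℤ.∣ a ⊖ b ∣ ℕ.* 2                        ≡⟨ cong (ℕ._* 2) (∣m⊖n∣≡∣m-n∣ a b) ⟩
  ∣ a - b ∣ ℕ.* 2                          ∎
  where open ≡.≡-Reasoning

toℚᵘ-∣a/2-b/2∣ : ∀ a b → toℚᵘ (ℚ.∣ + a / 2 ℚ.- + b / 2 ∣) ≃ᵘ mkℚᵘ (+ (∣ a - b ∣ ℕ.* 2)) 3
toℚᵘ-∣a/2-b/2∣ a b = begin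
  toℚᵘ (ℚ.∣ a/2 ℚ.- b/2 ∣)                 ≈⟨ toℚᵘ-homo-∣-∣ (a/2 ℚ.- b/2) ⟩
  ℚᵘ.∣ toℚᵘ (a/2 ℚ.- b/2) ∣                ≈⟨ ∣-∣-cong (toℚᵘ-homo-+ a/2 (ℚ.- b/2)) ⟩
  ℚᵘ.∣ toℚᵘ a/2 ℚᵘ.+ toℚᵘ (ℚ.- b/2) ∣      ≈⟨ ∣-∣-cong (+-cong (toℚᵘ-fromℚᵘ (mkℚᵘ (+ a) 1)) -b/2) ⟩
  ℚᵘ.∣ mkℚᵘ (+ a) 1 ℚᵘ.- mkℚᵘ (+ b) 1 ∣    ≡⟨ cong (λ z → mkℚᵘ (+ z) 3) (∣a*2-b*2∣≡∣a-b∣*2 a b) ⟩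
  mkℚᵘ (+ (∣ a - b ∣ ℕ.* 2)) 3             ∎
  where
  open Data.Rational.Unnormalised.Properties.≃-Reasoning
  a/2 b/2 : ℚ
  a/2 = + a / 2
  b/2 = + b / 2
  -b/2 : toℚᵘ (ℚ.- b/2) ≃ᵘ ℚᵘ.- mkℚᵘ (+ b) 1
  -b/2 = ≃-trans (toℚᵘ-homo‿- b/2) (-‿cong (toℚᵘ-fromℚᵘ (mkℚᵘ (+ b) 1)))

∣a/2-b/2∣≤1⇔∣a-b∣≤2 : ∀ a b → ℚ.∣ + a / 2 ℚ.- + b / 2 ∣ ℚ.≤ + 1 / 1 ⇔ ∣ a - b ∣ ≤ 2
∣a/2-b/2∣≤1⇔∣a-b∣≤2 a b = mk⇔ to from
  where
  d = ∣ a - b ∣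
  to : ℚ.∣ + a / 2 ℚ.- + b / 2 ∣ ℚ.≤ + 1 / 1 → d ≤ 2
  to ≤1 with ≤-respˡ-≃ (toℚᵘ-∣a/2-b/2∣ a b) (toℚᵘ-mono-≤ ≤1)
  ... | *≤* d*2≤4 = *-cancelʳ-≤ d 2 2 (ℤ.drop‿+≤+ (subst (ℤ._≤ + 4) (ℤ.*-identityʳ _) d*2≤4))
  from : d ≤ 2 → ℚ.∣ + a / 2 ℚ.- + b / 2 ∣ ℚ.≤ + 1 / 1
  from d≤2 = toℚᵘ-cancel-≤ (≤-respˡ-≃ (≃-sym (toℚᵘ-∣a/2-b/2∣ a b))
    (*≤* (subst (ℤ._≤ + 4) (≡.sym (ℤ.*-identityʳ _)) (ℤ.+≤+ (*-monoˡ-≤ 2 d≤2)))))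

-- Vertex v is the interval [l v / 2 , l v / 2 + 1].
unitIntervalGraph : ∀ {m} → (Fin m → ℕ) → Graph
unitIntervalGraph {m} l = record
  { n = m
  ; adj = λ u v → not (does (u ≟ v)) ∧ (∣ l u - l v ∣ ≤ᵇ 2)
  ; sym = λ u v → cong₂ (λ e d → not e ∧ (d ≤ᵇ 2))
                        (does-⇔ (mk⇔ ≡.sym ≡.sym) (u ≟ v) (v ≟ u)) (∣-∣-comm (l u) (l v))
  ; irrefl = λ v → cong (λ e → not e ∧ (∣ l v - l v ∣ ≤ᵇ 2)) (dec-true (v ≟ v) refl)
  }

module _ {m} (l : Fin m → ℕ) where

  unitIntervalGraph-adjacent : ∀ {u v} → u ≢ v → Adjacent (unitIntervalGraph l) u v ⇔ ∣ l u - l v ∣ ≤ 2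
  unitIntervalGraph-adjacent {u} {v} u≢v =
    mk⇔ (≤ᵇ⇒≤ _ _ ∘ Equivalence.from T-≡ ∘ trans (≡.sym adj≡)) (trans adj≡ ∘ Equivalence.to T-≡ ∘ ≤⇒≤ᵇ)
    where
    adj≡ : adj (unitIntervalGraph l) u v ≡ (∣ l u - l v ∣ ≤ᵇ 2)
    adj≡ = cong (λ e → not e ∧ (∣ l u - l v ∣ ≤ᵇ 2)) (dec-false (u ≟ v) u≢v)

  unitIntervalGraph-isUnitInterval : IsUnitInterval (unitIntervalGraph l)
  unitIntervalGraph-isUnitInterval = (λ v → + l v / 2) , λ u v u≢v →
    ⇔-trans (unitIntervalGraph-adjacent u≢v) (⇔-sym (∣a/2-b/2∣≤1⇔∣a-b∣≤2 (l u) (l v)))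

  unitIntervalGraph-independent≤windows :
    ∀ {c} (start : Fin c → ℕ) (window : Fin m → Fin c) →
    (∀ v → start (window v) ≤ l v × l v ≤ start (window v) ℕ.+ 2) →
    ∀ T → IsIndependent (unitIntervalGraph l) T → ∣ T ∣ ≤ c
  unitIntervalGraph-independent≤windows {c} start window in-window T independent =
    ≤-trans (∣p∣≤∣q∣-by-injection window (λ _ → ∈⊤) injective) (≤-reflexive (∣⊤∣≡n c))
    where
    injective : ∀ {u v} → u ∈ T → v ∈ T → window u ≡ window v → u ≡ v
    injective {u} {v} u∈T v∈T same with u ≟ v
    ... | yes u≡v = u≡v
    ... | no u≢v = ⊥-elim (independent u v u∈T v∈T (Equivalence.from (unitIntervalGraph-adjacent u≢v) close))
      where
      close : ∣ l u - l v ∣ ≤ 2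
      close with in-window u | subst (λ j → start j ≤ l v × l v ≤ start j ℕ.+ 2) (≡.sym same) (in-window v)
      ... | s≤u , u≤s+2 | s≤v , v≤s+2 = ∣a-b∣≤d-in-[s,s+d] s≤u u≤s+2 s≤v v≤s+2

size : ℕ → ℕ
size k = 3 ℕ.+ k ℕ.* 6

pattern v₀ = zero
pattern v₁ = suc v₀
pattern v₂ = suc v₁
pattern v₃ = suc v₂
pattern v₄ = suc v₃
pattern v₅ = suc v₄
pattern ↑ i = suc (suc (suc (suc (suc (suc i)))))

-- In chain (suc k), ↑ i is vertex i of the copy of chain k that follows v₀, …, v₅.
position : ∀ k → Fin (size k) → ℕ
position k v₀ = 0
position k v₁ = 1
position k v₂ = 2
position (suc k) v₃ = 4
position (suc k) v₄ = 6
position (suc k) v₅ = 8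
position (suc k) (↑ i) = 10 ℕ.+ position k i

chain : ℕ → Graph
chain k = unitIntervalGraph (position k)

↑≁v₅ : ∀ k v → v ≢ v₀ → adj (chain (suc k)) (↑ v) v₅ ≡ false
↑≁v₅ k v₀ v≢v₀ = ⊥-elim (v≢v₀ refl)
↑≁v₅ k v₁ _ = refl
↑≁v₅ k v₂ _ = refl
↑≁v₅ (suc k) v₃ _ = refl
↑≁v₅ (suc k) v₄ _ = refl
↑≁v₅ (suc k) v₅ _ = refl
↑≁v₅ (suc k) (↑ _) _ = refl

degree-v₀ : ∀ k → degree (chain k) v₀ ≡ 2
degree-v₀ zero = refl
degree-v₀ (suc k) = cong (2 ℕ.+_) (∣tabulate-outside∣ (size k))

degree-v₄ : ∀ k → degree (chain (suc k)) v₄ ≡ 2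
degree-v₄ k = cong (2 ℕ.+_) (∣tabulate-outside∣ (size k))

degree-v₅ : ∀ k → degree (chain (suc k)) v₅ ≡ 2
degree-v₅ k = cong (2 ℕ.+_) (trans (cong ∣_∣ (tabulate-cong v₅≁↑suc)) (∣tabulate-outside∣ (2 ℕ.+ k ℕ.* 6)))
  where
  v₅≁↑suc : ∀ i → adj (chain (suc k)) v₅ (↑ (suc i)) ≡ outside
  v₅≁↑suc i = trans (Graph.sym (chain (suc k)) v₅ (↑ (suc i))) (↑≁v₅ k (suc i) λ ())

chain-maxDegree : ∀ k → MaxDegreeAtMost (chain k) 3
chain-maxDegree zero v₀ = ≤ᵇ⇒≤ _ _ tt
chain-maxDegree zero v₁ = ≤ᵇ⇒≤ _ _ tt
chain-maxDegree zero v₂ = ≤ᵇ⇒≤ _ _ tt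
chain-maxDegree (suc k) v₀ = ≤-trans (≤-reflexive (degree-v₀ (suc k))) (≤ᵇ⇒≤ _ _ tt)
chain-maxDegree (suc k) v₁ = ≤-trans (≤-reflexive (cong (2 ℕ.+_) (∣tabulate-outside∣ (size k)))) (≤ᵇ⇒≤ _ _ tt)
chain-maxDegree (suc k) v₂ = ≤-reflexive (cong (3 ℕ.+_) (∣tabulate-outside∣ (size k)))
chain-maxDegree (suc k) v₃ = ≤-trans (≤-reflexive (cong (2 ℕ.+_) (∣tabulate-outside∣ (size k)))) (≤ᵇ⇒≤ _ _ tt)
chain-maxDegree (suc k) v₄ = ≤-trans (≤-reflexive (degree-v₄ k)) (≤ᵇ⇒≤ _ _ tt)
chain-maxDegree (suc k) v₅ = ≤-trans (≤-reflexive (degree-v₅ k)) (≤ᵇ⇒≤ _ _ tt)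
chain-maxDegree (suc k) (↑ v₀) = ≤-reflexive (cong suc (degree-v₀ k))
chain-maxDegree (suc k) (↑ (suc v)) =
  subst (_≤ 3) (≡.sym (∣b∷p∣-outside (N (chain k) (suc v)) (↑≁v₅ k (suc v) λ ()))) (chain-maxDegree k (suc v))

chain-2≤degreeIn⊤ : ∀ k v → 2 ≤ degreeIn (chain k) ⊤ v
chain-2≤degreeIn⊤ zero v₀ = ≤ᵇ⇒≤ _ _ tt
chain-2≤degreeIn⊤ zero v₁ = ≤ᵇ⇒≤ _ _ tt
chain-2≤degreeIn⊤ zero v₂ = ≤ᵇ⇒≤ _ _ tt
chain-2≤degreeIn⊤ (suc k) v₀ = s≤s (s≤s z≤n)
chain-2≤degreeIn⊤ (suc k) v₁ = s≤s (s≤s z≤n)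
chain-2≤degreeIn⊤ (suc k) v₂ = s≤s (s≤s z≤n)
chain-2≤degreeIn⊤ (suc k) v₃ = s≤s (s≤s z≤n)
chain-2≤degreeIn⊤ (suc k) v₄ = s≤s (s≤s z≤n)
chain-2≤degreeIn⊤ (suc k) v₅ = s≤s (s≤s z≤n)
chain-2≤degreeIn⊤ (suc k) (↑ v) =
  ≤-trans (chain-2≤degreeIn⊤ k v) (∣p∣≤∣x∷p∣ (adj (chain (suc k)) (↑ v) v₅) (⊤ ∩ N (chain k) v))

pad : ∀ k → Subset (size k) → Subset (size (suc k))
pad _ R = outside ∷ outside ∷ outside ∷ outside ∷ outside ∷ outside ∷ R

pattern ∈↑ x∈R = there (there (there (there (there (there x∈R)))))

pad-Empty : ∀ {k} {R : Subset (size k)} → Empty R → Empty (pad k R)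
pad-Empty R-empty (_ , ∈↑ x∈R) = R-empty (_ , x∈R)

pad-─ : ∀ k (R : Subset (size k)) v → pad k R ─ N[ chain (suc k) ] (↑ v) ≡ pad k (R ─ N[ chain k ] v)
pad-─ k R v = cong (λ X → outside ∷ outside ∷ outside ∷ outside ∷ outside ∷ X)
                   (outside∷p─b∷q (adj (chain (suc k)) (↑ v) v₅) R (N[ chain k ] v))

greedyRun-pad : ∀ {k R S} → GreedyRun (chain k) R S → GreedyRun (chain (suc k)) (pad k R) (pad k S)
greedyRun-pad {k} (done R-empty) = done (pad-Empty {k} R-empty)
greedyRun-pad {k} (step {R} {S} v v∈R v-minimal run) =
  step (↑ v) (∈↑ v∈R) (λ { _ (∈↑ u∈R) → v-minimal _ u∈R })
       (subst (λ X → GreedyRun (chain (suc k)) X (pad k S)) (≡.sym (pad-─ k R v)) (greedyRun-pad run))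

greedySet : ∀ k → Subset (size k)
greedySet zero = inside ∷ outside ∷ outside ∷ []
greedySet (suc k) = inside ∷ outside ∷ outside ∷ outside ∷ inside ∷ outside ∷ greedySet k

∣greedySet∣ : ∀ k → ∣ greedySet k ∣ ≡ 1 ℕ.+ k ℕ.* 2
∣greedySet∣ zero = refl
∣greedySet∣ (suc k) = cong (2 ℕ.+_) (∣greedySet∣ k)

pathRemoved : ∀ k → Subset (size (suc k))
pathRemoved k = inside ∷ inside ∷ inside ∷ outside ∷ outside ∷ outside ∷ ⊤

greedySet-returned : ∀ k → GreedyReturns (chain k) (greedySet k)
greedySet-returned zero =
  greedy-step (chain zero) v₀ ∈⊤ (λ u _ → ≤-trans (≤-reflexive (degree-v₀ zero)) (chain-2≤degreeIn⊤ zero u))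
    (done λ (_ , x∈⊥) → ∉⊥ x∈⊥)
greedySet-returned (suc k) =
  subst (GreedyRun G ⊤) chosen
    (greedy-step G v₄ ∈⊤ v₄-minimal
      (subst (λ R → GreedyRun G R (⁅ v₀ ⁆ ∪ pad k (greedySet k))) (≡.sym path-removed)
        (greedy-step G v₀ here v₀-minimal
          (subst (λ R → GreedyRun G R (pad k (greedySet k))) (≡.sym triangle-removed)
            (greedyRun-pad (greedySet-returned k))))))
  where
  G = chain (suc k)
  v₄-minimal : ∀ u → u ∈ ⊤ → degree G v₄ ≤ degreeIn G ⊤ u
  v₄-minimal u _ = ≤-trans (≤-reflexive (degree-v₄ k)) (chain-2≤degreeIn⊤ (suc k) u)
  path-removed : ⊤ ─ N[ G ] v₄ ≡ pathRemoved k
  path-removed = cong (λ R → inside ∷ inside ∷ inside ∷ outside ∷ outside ∷ outside ∷ R)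
                      (⊤─tabulate-outside (size k))
  2≤degreeIn : ∀ u → u ∈ pathRemoved k → 2 ≤ degreeIn G (pathRemoved k) u
  2≤degreeIn v₀ here = s≤s (s≤s z≤n)
  2≤degreeIn v₁ (there here) = s≤s (s≤s z≤n)
  2≤degreeIn v₂ (there (there here)) = s≤s (s≤s z≤n)
  2≤degreeIn (↑ u) (∈↑ _) = chain-2≤degreeIn⊤ k u
  v₀-minimal : ∀ u → u ∈ pathRemoved k → degree G v₀ ≤ degreeIn G (pathRemoved k) u
  v₀-minimal u u∈ = ≤-trans (≤-reflexive (degree-v₀ (suc k))) (2≤degreeIn u u∈)
  triangle-removed : pathRemoved k ─ N[ G ] v₀ ≡ pad k ⊤
  triangle-removed = cong (pad k) (⊤─tabulate-outside (size k))
  chosen : ⁅ v₄ ⁆ ∪ (⁅ v₀ ⁆ ∪ pad k (greedySet k)) ≡ greedySet (suc k)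
  chosen = cong (λ S → inside ∷ outside ∷ outside ∷ outside ∷ inside ∷ outside ∷ S)
                (trans (∪-identityˡ _) (∪-identityˡ (greedySet k)))

spreadSet : ∀ k → Subset (size k)
spreadSet zero = outside ∷ inside ∷ outside ∷ []
spreadSet (suc k) = outside ∷ inside ∷ outside ∷ inside ∷ outside ∷ inside ∷ spreadSet k

∣spreadSet∣ : ∀ k → ∣ spreadSet k ∣ ≡ 1 ℕ.+ k ℕ.* 3
∣spreadSet∣ zero = refl
∣spreadSet∣ (suc k) = cong (3 ℕ.+_) (∣spreadSet∣ k)

v₀∉spreadSet : ∀ k → v₀ ∉ spreadSet k
v₀∉spreadSet zero ()
v₀∉spreadSet (suc k) ()

↑spreadSet≁v₅ : ∀ k {w} → w ∈ spreadSet k → ¬ Adjacent (chain (suc k)) (↑ w) v₅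
↑spreadSet≁v₅ k {w} w∈ a = case trans (≡.sym (↑≁v₅ k w λ { refl → v₀∉spreadSet k w∈ })) a of λ ()

pattern ∈v₁ = there here
pattern ∈v₃ = there (there (there here))
pattern ∈v₅ = there (there (there (there (there here))))

spreadSet-independent : ∀ k → IsIndependent (chain k) (spreadSet k)
spreadSet-independent zero v₁ v₁ ∈v₁ ∈v₁ ()
spreadSet-independent zero _ _ (there (there (there ()))) _
spreadSet-independent zero _ _ _ (there (there (there ())))
spreadSet-independent (suc k) v₁ v₁ ∈v₁ ∈v₁ ()
spreadSet-independent (suc k) v₁ v₃ ∈v₁ ∈v₃ ()
spreadSet-independent (suc k) v₁ v₅ ∈v₁ ∈v₅ ()
spreadSet-independent (suc k) v₁ (↑ _) ∈v₁ (∈↑ _) ()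
spreadSet-independent (suc k) v₃ v₁ ∈v₃ ∈v₁ ()
spreadSet-independent (suc k) v₃ v₃ ∈v₃ ∈v₃ ()
spreadSet-independent (suc k) v₃ v₅ ∈v₃ ∈v₅ ()
spreadSet-independent (suc k) v₃ (↑ _) ∈v₃ (∈↑ _) ()
spreadSet-independent (suc k) v₅ v₁ ∈v₅ ∈v₁ ()
spreadSet-independent (suc k) v₅ v₃ ∈v₅ ∈v₃ ()
spreadSet-independent (suc k) v₅ v₅ ∈v₅ ∈v₅ ()
spreadSet-independent (suc k) v₅ (↑ w) ∈v₅ (∈↑ w∈) a =
  ↑spreadSet≁v₅ k w∈ (trans (≡.sym (Graph.sym (chain (suc k)) v₅ (↑ w))) a)
spreadSet-independent (suc k) (↑ _) v₁ (∈↑ _) ∈v₁ ()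
spreadSet-independent (suc k) (↑ _) v₃ (∈↑ _) ∈v₃ ()
spreadSet-independent (suc k) (↑ u) v₅ (∈↑ u∈) ∈v₅ a = ↑spreadSet≁v₅ k u∈ a
spreadSet-independent (suc k) (↑ u) (↑ w) (∈↑ u∈) (∈↑ w∈) a = spreadSet-independent k u w u∈ w∈ a

clique : ∀ k → Fin (size k) → Fin (1 ℕ.+ k ℕ.* 3)
clique k v₀ = zero
clique k v₁ = zero
clique k v₂ = zero
clique (suc k) v₃ = suc zero
clique (suc k) v₄ = suc zero
clique (suc k) v₅ = suc (suc zero)
clique (suc k) (↑ v) = suc (suc (suc (clique k v)))

cliqueStart : ℕ → ℕ
cliqueStart 0 = 0
cliqueStart 1 = 4
cliqueStart 2 = 8
cliqueStart (suc (suc (suc j))) = 10 ℕ.+ cliqueStart j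

position-in-clique : ∀ k v → cliqueStart (toℕ (clique k v)) ≤ position k v ×
                             position k v ≤ cliqueStart (toℕ (clique k v)) ℕ.+ 2
position-in-clique k v₀ = ≤ᵇ⇒≤ _ _ tt , ≤ᵇ⇒≤ _ _ tt
position-in-clique k v₁ = ≤ᵇ⇒≤ _ _ tt , ≤ᵇ⇒≤ _ _ tt
position-in-clique k v₂ = ≤ᵇ⇒≤ _ _ tt , ≤ᵇ⇒≤ _ _ tt
position-in-clique (suc k) v₃ = ≤ᵇ⇒≤ _ _ tt , ≤ᵇ⇒≤ _ _ tt
position-in-clique (suc k) v₄ = ≤ᵇ⇒≤ _ _ tt , ≤ᵇ⇒≤ _ _ tt
position-in-clique (suc k) v₅ = ≤ᵇ⇒≤ _ _ tt , ≤ᵇ⇒≤ _ _ tt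
position-in-clique (suc k) (↑ v) with position-in-clique k v
... | start≤ , ≤end = +-monoʳ-≤ 10 start≤ , +-monoʳ-≤ 10 ≤end

chain-independent≤ : ∀ k T → IsIndependent (chain k) T → ∣ T ∣ ≤ 1 ℕ.+ k ℕ.* 3
chain-independent≤ k =
  unitIntervalGraph-independent≤windows (position k) (cliqueStart ∘ toℕ) (clique k) (position-in-clique k)

cross-product-identity :
  ∀ d p → (2 ℕ.* d ℕ.+ suc p ℕ.* 3) ℕ.* (1 ℕ.+ d ℕ.* 3) ℕ.* 1
          ≡ (1 ℕ.+ d ℕ.* 2) ℕ.* (3 ℕ.* d ℕ.* 1) ℕ.+ suc (2 ℕ.+ d ℕ.* 8 ℕ.+ p ℕ.* 3 ℕ.+ p ℕ.* d ℕ.* 9)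
cross-product-identity = solve-∀

+-cross-product : ∀ d p a → + ((2 ℕ.* d ℕ.+ suc p ℕ.* 3) ℕ.* a ℕ.* 1)
                            ≡ ((+ 2 ℤ.* + d ℤ.+ +[1+ p ] ℤ.* + 3) ℤ.* + a) ℤ.* + 1
+-cross-product d p a = begin
  + (c ℕ.* a ℕ.* 1)                                    ≡⟨ ℤ.pos-* (c ℕ.* a) 1 ⟩
  + (c ℕ.* a) ℤ.* + 1                                  ≡⟨ cong (ℤ._* + 1) (ℤ.pos-* c a) ⟩
  (+ c ℤ.* + a) ℤ.* + 1                                ≡⟨ cong (λ x → (x ℤ.* + a) ℤ.* + 1) (ℤ.pos-+ (2 ℕ.* d) (suc p ℕ.* 3)) ⟩
  ((+ (2 ℕ.* d) ℤ.+ + (suc p ℕ.* 3)) ℤ.* + a) ℤ.* + 1  ≡⟨ cong (λ x → (x ℤ.* + a) ℤ.* + 1)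
                                                              (cong₂ ℤ._+_ (ℤ.pos-* 2 d) (ℤ.pos-* (suc p) 3)) ⟩
  ((+ 2 ℤ.* + d ℤ.+ +[1+ p ] ℤ.* + 3) ℤ.* + a) ℤ.* + 1 ∎
  where
  open ≡.≡-Reasoning
  c = 2 ℕ.* d ℕ.+ suc p ℕ.* 3

cross-product-< : ∀ d p → + (1 ℕ.+ d ℕ.* 2) ℤ.* + (3 ℕ.* d ℕ.* 1)
                          ℤ.< ((+ 2 ℤ.* + d ℤ.+ +[1+ p ] ℤ.* + 3) ℤ.* + (1 ℕ.+ d ℕ.* 3)) ℤ.* + 1
cross-product-< d p = subst₂ ℤ._<_ (ℤ.pos-* (1 ℕ.+ d ℕ.* 2) (3 ℕ.* d ℕ.* 1)) (+-cross-product d p (1 ℕ.+ d ℕ.* 3))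
  (+<+ (subst (lhs ℕ.<_) (≡.sym (cross-product-identity d p)) (m<m+n lhs (s≤s z≤n))))
  where lhs = (1 ℕ.+ d ℕ.* 2) ℕ.* (3 ℕ.* d ℕ.* 1)

-- (2/3 + ε) (3k + 1) - (2k + 1) = ε (3k + 1) - 1/3, which is positive for k = e + 1
-- when ε = (p + 1) / (e + 1).
1+2k<[2/3+ε][1+3k] : ∀ ε → 0ℚ < ε →
  Σ ℕ λ k → (+ (1 ℕ.+ k ℕ.* 2) / 1) < (((+ 2 / 3) + ε) * (+ (1 ℕ.+ k ℕ.* 3) / 1))
1+2k<[2/3+ε][1+3k] ε@(mkℚ +[1+ p ] e _) _ = suc e , toℚᵘ-cancel-< (begin-strict
  toℚᵘ (+ s / 1)                                          ≃⟨ toℚᵘ-fromℚᵘ (mkℚᵘ (+ s) 0) ⟩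
  mkℚᵘ (+ s) 0                                            <⟨ *<* (cross-product-< (suc e) p) ⟩
  (mkℚᵘ (+ 2) 2 ℚᵘ.+ mkℚᵘ +[1+ p ] e) ℚᵘ.* mkℚᵘ (+ a) 0  ≃⟨ ≃-sym (≃-trans (toℚᵘ-homo-* ((+ 2 / 3) + ε) (+ a / 1))
                                                              (*-cong (toℚᵘ-homo-+ (+ 2 / 3) ε) (toℚᵘ-fromℚᵘ (mkℚᵘ (+ a) 0)))) ⟩
  toℚᵘ (((+ 2 / 3) + ε) * (+ a / 1))                      ∎)
  where
  open Data.Rational.Unnormalised.Properties.≤-Reasoning
  s = 1 ℕ.+ suc e ℕ.* 2
  a = 1 ℕ.+ suc e ℕ.* 3
1+2k<[2/3+ε][1+3k] (mkℚ (+ 0) _ _) (ℚ.*<* (+<+ ()))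
1+2k<[2/3+ε][1+3k] (mkℚ -[1+ _ ] _ _) (ℚ.*<* ())

lemma4 : (ε : ℚ) → 0ℚ < ε →
    Σ Graph λ G → IsUnitInterval G × MaxDegreeAtMost G 3 ×
      Σ (Subset (n G)) λ S → GreedyReturns G S × IsIndependent G S ×
        Σ ℕ λ a → IsIndependenceNumber G a ×
          ((+ ∣ S ∣ / 1) < (((+ 2 / 3) + ε) * (+ a / 1)))
lemma4 ε ε>0 with 1+2k<[2/3+ε][1+3k] ε ε>0
... | k , ratio =
  chain k , unitIntervalGraph-isUnitInterval (position k) , chain-maxDegree k ,
  greedySet k , greedySet-returned k , greedyRun-independent (chain k) (greedySet-returned k) ,
  1 ℕ.+ k ℕ.* 3 , ((spreadSet k , spreadSet-independent k , ∣spreadSet∣ k) , chain-independent≤ k) ,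
  subst (λ s → + s / 1 < ((+ 2 / 3) + ε) * (+ (1 ℕ.+ k ℕ.* 3) / 1)) (≡.sym (∣greedySet∣ k)) ratio
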